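{- For all integers $r\geq2$ and $n\ge0$, $\mathcal{A}''_r(n)=\mathcal{D}_{r,r-1}(n)$.
   Context: A partition $\lambda=(\lambda_1,\dots,\lambda_s)$ is a non-increasing finite sequence of positive integers. For a (possibly empty) partition $\mu=(\mu_1,\dots,\mu_t)$ let $\mathrm{sq}(\mu)=\max\{d\ge0:d\le t,\ \mu_d\ge d\}$ (Durfee square side) and $\mathrm{rect}(\mu)=\max\{h\ge0:h\le t,\ \mu_h\ge h+1\}$ (height of the horizontal Durfee rectangle with $h$ rows and $h+1$ columns). Successive Durfee squares of $\lambda$: $\mu^{(0)}=\lambda$, $n_j=\mathrm{sq}(\mu^{(j-1)})$, $\mu^{(j)}$ is $\mu^{(j-1)}$ with its first $n_j$ parts deleted. $\mathcal{A}''_r(n)$ is the disjoint union of: the set of partitions of $n$ with $\mu^{(r-2)}$ empty (at most $r-2$ non-empty Durfee squares), and the set $\mathcal{A}'_r(n)$ of partitions of $n$ with exactly $r-1$ non-empty successive Durfee squares ($n_1,\dots,n_{r-1}\ge1$, $n_1+\dots+n_{r-1}=s$) such that $\lambda_{n_1+\dots+n_j}>n_j$ for at least one $j\in\{1,\dots,r-1\}$. $\mathcal{D}_{r,r-1}(n)$ is the set of partitions $\lambda$ of $n$ such that, with $\nu^{(0)}=\lambda$, $\nu^{(1)}$ equal to $\lambda$ with its first $\mathrm{rect}(\lambda)$ parts deleted, and $\nu^{(j)}$ ($j\ge2$) equal to $\nu^{(j-1)}$ with its first $\mathrm{sq}(\nu^{(j-1)})$ parts deleted, $\nu^{(r-1)}$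 is empty. -}

module Defs where

open import Data.Nat using (ℕ; zero; suc; _+_; _∸_; _≤_; _<_; _≤?_)
open import Data.List using (List; []; _∷_; length; drop)
open import Data.Nat.ListAction using (sum)
open import Data.List.Relation.Unary.All using (All)
open import Data.List.Relation.Unary.Linked using (Linked)
open import Data.Product using (_×_; ∃-syntax)
open import Data.Sum using (_⊎_)
open import Relation.Binary.PropositionalEquality using (_≡_)
open import Relation.Nullary using (Dec; yes; no)
open import Relation.Unary using (Pred; Decidable)
open import Level using (0ℓ)

IsPartition : List ℕ → Set
IsPartition μ = All (λ x → 1 ≤ x) μ × Linked (λ a b → b ≤ a) μ

PartitionOf : ℕ → List ℕ → Set
PartitionOf n μ = IsPartition μ × sum μ ≡ n

-- 1-indexed part: part μ i = μ_i  (i ≥ 1); 0 outside the range (never used there).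
part : List ℕ → ℕ → ℕ
part []       _             = 0
part (x ∷ xs) zero          = 0
part (x ∷ xs) (suc zero)    = x
part (x ∷ xs) (suc (suc i)) = part xs (suc i)

-- largest d with 0 ≤ d ≤ t such that (d = 0 or P d)
maxUpTo : (P : Pred ℕ 0ℓ) → Decidable P → ℕ → ℕ
maxUpTo P P? zero    = zero
maxUpTo P P? (suc t) with P? (suc t)
... | yes _ = suc t
... | no  _ = maxUpTo P P? t

-- Durfee square side: max{d ≤ t : μ_d ≥ d}
sq : List ℕ → ℕ
sq μ = maxUpTo (λ d → d ≤ part μ d) (λ d → d ≤? part μ d) (length μ)

-- height of horizontal Durfee rectangle: max{h ≤ t : μ_h ≥ h+1}
rect : List ℕ → ℕ
rect μ = maxUpTo (λ h → suc h ≤ part μ h) (λ h → suc h ≤? part μ h) (length μ)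

mu : ℕ → List ℕ → List ℕ
mu zero    l = l
mu (suc j) l = drop (sq (mu j l)) (mu j l)

nsq : ℕ → List ℕ → ℕ
nsq j l = sq (mu (j ∸ 1) l)

psum : ℕ → List ℕ → ℕ
psum zero    l = 0
psum (suc j) l = psum j l + nsq (suc j) l

InA′ : ℕ → ℕ → List ℕ → Set
InA′ r n l =
  PartitionOf n l
  × (∀ j → 1 ≤ j → j ≤ r ∸ 1 → 1 ≤ nsq j l)
  × psum (r ∸ 1) l ≡ length l
  × ∃[ j ] (1 ≤ j × j ≤ r ∸ 1 × nsq j l < part l (psum j l))

InA″ : ℕ → ℕ → List ℕ → Set
InA″ r n l = (PartitionOf n l × mu (r ∸ 2) l ≡ []) ⊎ InA′ r n l

nu : ℕ → List ℕ → List ℕ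
nu zero          l = l
nu (suc zero)    l = drop (rect l) l
nu (suc (suc j)) l = drop (sq (nu (suc j) l)) (nu (suc j) l)

InD : ℕ → ℕ → List ℕ → Set
InD r n l = PartitionOf n l × nu (r ∸ 1) l ≡ []

module Submission where

-- If the first Durfee square of λ (side d ≥ 1) is strict, λ_d > d, then rect λ = d, so ν and
-- μ make the same first step and coincide from then on. If it is tight, λ_d = d, then
-- rect λ = d − 1 and ν^(1) is μ^(1) with the row d put back on top; since d ∷ m has Durfee side
-- 1 + rect m, the next square step removes that row together with the rectangle of μ^(1), so
-- ν^(j+1)(λ) = ν^(j)(μ^(1)) for j ≥ 1. By induction, ν^(r−1) = ∅ iff μ^(r−1) = ∅ and one of the
-- first r − 1 squares is strict. An empty square counts as strict, which accounts for the
-- partitions of 𝒜'' with fewer than r − 1 squares.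

open import Defs
open import Data.Nat using (ℕ; zero; suc; _+_; _∸_; _≤_; _≥_; _<_; _≤?_; z≤n; s≤s; z<s; s<s; s≤s⁻¹)
open import Data.Nat.Properties
open import Data.List using (List; []; _∷_; length; drop)
open import Data.List.Properties using (length-drop; drop-drop; drop-all; ≡-dec)
open import Data.List.Relation.Unary.All using (All; _∷_)
open import Data.List.Relation.Unary.All.Properties using (drop⁺)
open import Data.List.Relation.Unary.Linked using (Linked; []; [-]; _∷_)
import Data.List.Relation.Unary.Linked as Linked
open import Data.Product using (_×_; _,_; proj₁; ∃-syntax)
open import Data.Sum using (_⊎_; inj₁; inj₂; [_,_]′)
open import Function using (_∘_; id; case_of_)
open import Function.Bundles using (_⇔_; mk⇔; Equivalence)
open import Function.Construct.Composition using (_⇔-∘_)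
open import Function.Construct.Symmetry using (⇔-sym)
open import Level using (0ℓ)
open import Relation.Binary using (Rel)
open import Relation.Binary.PropositionalEquality
open import Relation.Nullary using (¬_; yes; no; contradiction)
open import Relation.Unary using (Pred; Decidable)

module _ (P : Pred ℕ 0ℓ) (P? : Decidable P) where

  maxUpTo-≤ : ∀ t → maxUpTo P P? t ≤ t
  maxUpTo-≤ zero = z≤n
  maxUpTo-≤ (suc t) with P? (suc t)
  ... | yes _ = ≤-refl
  ... | no  _ = m≤n⇒m≤1+n (maxUpTo-≤ t)

  maxUpTo-sound : ∀ t → maxUpTo P P? t ≡ 0 ⊎ P (maxUpTo P P? t)
  maxUpTo-sound zero = inj₁ refl
  maxUpTo-sound (suc t) with P? (suc t)
  ... | yes p = inj₂ p
  ... | no  _ = maxUpTo-sound t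

  maxUpTo-maximal : ∀ t {e} → maxUpTo P P? t < e → e ≤ t → ¬ P e
  maxUpTo-maximal zero    M<e e≤t _ = <-irrefl refl (<-≤-trans M<e e≤t)
  maxUpTo-maximal (suc t) M<e e≤t pe with P? (suc t)
  ... | yes _ = <-irrefl refl (<-≤-trans M<e e≤t)
  ... | no ¬p with m≤n⇒m<n∨m≡n e≤t
  ...   | inj₁ e≤t′ = maxUpTo-maximal t M<e (s≤s⁻¹ e≤t′) pe
  ...   | inj₂ refl = ¬p pe

  maxUpTo-unique : ∀ t {d} → d ≤ t → d ≡ 0 ⊎ P d → (∀ {e} → d < e → e ≤ t → ¬ P e) →
                   maxUpTo P P? t ≡ d
  maxUpTo-unique t {d} d≤t d-ok d-max = ≤-antisym (≮⇒≥ M≮d) (≮⇒≥ d≮M)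
    where
    M≮d : ¬ d < maxUpTo P P? t
    M≮d d<M = [ (λ M≡0 → n≮0 (subst (d <_) M≡0 d<M)) , d-max d<M (maxUpTo-≤ t) ]′ (maxUpTo-sound t)
    d≮M : ¬ maxUpTo P P? t < d
    d≮M M<d = [ (λ d≡0 → n≮0 (subst (_ <_) d≡0 M<d)) , maxUpTo-maximal t M<d d≤t ]′ d-ok

linked-drop⁺ : ∀ {R : Rel ℕ 0ℓ} k {xs} → Linked R xs → Linked R (drop k xs)
linked-drop⁺ zero                lxs = lxs
linked-drop⁺ (suc k) {[]}        _   = []
linked-drop⁺ (suc k) {_ ∷ _}     lxs = linked-drop⁺ k (Linked.tail lxs)

part-antitone : ∀ {l} → Linked _≥_ l → ∀ i → part l (suc (suc i)) ≤ part l (suc i)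
part-antitone []                  i       = z≤n
part-antitone [-]                 i       = z≤n
part-antitone (x≥y ∷ _)           zero    = x≥y
part-antitone (_ ∷ desc@(_ ∷ _))  (suc i) = part-antitone desc i
part-antitone (_ ∷ [-])           (suc i) = z≤n

part-drop : ∀ p l {i} → 1 ≤ i → part (drop p l) i ≡ part l (p + i)
part-drop zero    l        _       = refl
part-drop (suc p) []       _       = refl
part-drop (suc p) (x ∷ xs) {suc i} _ rewrite +-suc p i =
  trans (part-drop p xs (s≤s z≤n)) (cong (part xs) (+-suc p i))

drop-part-∷ : ∀ e l → suc e ≤ length l → drop e l ≡ part l (suc e) ∷ drop (suc e) l
drop-part-∷ zero    (x ∷ xs) _ = refl
drop-part-∷ (suc e) (x ∷ xs) e<len = drop-part-∷ e xs (s≤s⁻¹ e<len)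

SqSide : List ℕ → Pred ℕ 0ℓ
SqSide l d = d ≤ part l d

sqSide? : ∀ l → Decidable (SqSide l)
sqSide? l d = d ≤? part l d

RectHeight : List ℕ → Pred ℕ 0ℓ
RectHeight l h = suc h ≤ part l h

rectHeight? : ∀ l → Decidable (RectHeight l)
rectHeight? l h = suc h ≤? part l h

sq-≤-length : ∀ l → sq l ≤ length l
sq-≤-length l = maxUpTo-≤ (SqSide l) (sqSide? l) (length l)

sq-maximal : ∀ l {e} → sq l < e → e ≤ length l → ¬ SqSide l e
sq-maximal l = maxUpTo-maximal (SqSide l) (sqSide? l) (length l)

-- Row i + 1 of d ∷ m is row i of m, so the square condition at i + 1 for d ∷ m is the
-- rectangle condition at i for m.
sq-∷ : ∀ {d} m → 1 ≤ d → sq (d ∷ m) ≡ suc (rect m)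
sq-∷ {d} m 1≤d = shift (length m)
  where
  shift : ∀ t → maxUpTo (SqSide (d ∷ m)) (sqSide? (d ∷ m)) (suc t)
              ≡ suc (maxUpTo (RectHeight m) (rectHeight? m) t)
  shift zero with 1 ≤? d
  ... | yes _   = refl
  ... | no 1≰d = contradiction 1≤d 1≰d
  shift (suc t) with suc (suc t) ≤? part m (suc t)
  ... | yes _ = refl
  ... | no  _ = shift t

sq-pos : ∀ {m} → All (1 ≤_) m → m ≢ [] → 1 ≤ sq m
sq-pos {[]}     _         m≢[] = contradiction refl m≢[]
sq-pos {_ ∷ xs} (1≤x ∷ _) _    rewrite sq-∷ xs 1≤x = s≤s z≤n

StrictSq : List ℕ → Set
StrictSq l = sq l ≡ 0 ⊎ sq l < part l (sq l)

TightSq : List ℕ → Set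
TightSq l = ∃[ e ] (sq l ≡ suc e × part l (suc e) ≡ suc e)

strict⊎tight : ∀ l → StrictSq l ⊎ TightSq l
strict⊎tight l = classify (sq l) refl (maxUpTo-sound (SqSide l) (sqSide? l) (length l))
  where
  classify : ∀ d → sq l ≡ d → d ≡ 0 ⊎ SqSide l d → StrictSq l ⊎ TightSq l
  classify zero    sq≡0 _          = inj₁ (inj₁ sq≡0)
  classify (suc e) sq≡d (inj₂ d≤) with m≤n⇒m<n∨m≡n d≤
  ... | inj₁ d< = inj₁ (inj₂ (subst (λ d → d < part l d) (sym sq≡d) d<))
  ... | inj₂ d≡ = inj₂ (e , sq≡d , sym d≡)

strict⇒¬tight : ∀ l → StrictSq l → ¬ TightSq l
strict⇒¬tight _ (inj₁ sq≡0) (_ , sq≡1+e , _)       = 0≢1+n (trans (sym sq≡0) sq≡1+e)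
strict⇒¬tight l (inj₂ sq<) (e , sq≡1+e , part≡) =
  <-irrefl refl (≤-trans (subst (λ d → d < part l d) sq≡1+e sq<) (≤-reflexive part≡))

rect-strict : ∀ l → StrictSq l → rect l ≡ sq l
rect-strict l strict =
  maxUpTo-unique (RectHeight l) (rectHeight? l) (length l) (sq-≤-length l) strict
    (λ sq<e e≤len → sq-maximal l sq<e e≤len ∘ ≤-trans (n≤1+n _))

rect-tight : ∀ {l e} → Linked _≥_ l → sq l ≡ suc e → part l (suc e) ≡ suc e → rect l ≡ e
rect-tight {l} {e} desc sq≡1+e part≡ =
  maxUpTo-unique (RectHeight l) (rectHeight? l) (length l) e≤len (e-ok e part≡) e-max
  where
  e≤len : e ≤ length l
  e≤len = ≤-trans (n≤1+n e) (subst (_≤ length l) sq≡1+e (sq-≤-length l))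
  e-ok : ∀ e → part l (suc e) ≡ suc e → e ≡ 0 ⊎ RectHeight l e
  e-ok zero     _     = inj₁ refl
  e-ok (suc e′) part≡ = inj₂ (≤-trans (≤-reflexive (sym part≡)) (part-antitone desc e′))
  e-max : ∀ {h} → e < h → h ≤ length l → ¬ RectHeight l h
  e-max e<h h≤len h-ok with m≤n⇒m<n∨m≡n e<h
  ... | inj₂ refl = <-irrefl refl (≤-trans h-ok (≤-reflexive part≡))
  ... | inj₁ sq<h =
    sq-maximal l (subst (_< _) (sym sq≡1+e) sq<h) h≤len (≤-trans (n≤1+n _) h-ok)

dropSq : List ℕ → List ℕ
dropSq l = drop (sq l) l

dropRect : List ℕ → List ℕ
dropRect l = drop (rect l) l

mu-suc : ∀ k l → mu (suc k) l ≡ mu k (dropSq l)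
mu-suc zero    l = refl
mu-suc (suc k) l = cong dropSq (mu-suc k l)

nu-suc : ∀ k l → nu (suc k) l ≡ mu k (dropRect l)
nu-suc zero    l = refl
nu-suc (suc k) l = cong dropSq (nu-suc k l)

dropRect-strict : ∀ l → StrictSq l → dropRect l ≡ dropSq l
dropRect-strict l strict = cong (λ k → drop k l) (rect-strict l strict)

dropRect-tight : ∀ {l e} → Linked _≥_ l → sq l ≡ suc e → part l (suc e) ≡ suc e →
                 dropRect l ≡ suc e ∷ dropSq l
dropRect-tight {l} {e} desc sq≡1+e part≡ = begin
  drop (rect l) l                 ≡⟨ cong (λ k → drop k l) (rect-tight desc sq≡1+e part≡) ⟩
  drop e l                        ≡⟨ drop-part-∷ e l (subst (_≤ length l) sq≡1+e (sq-≤-length l)) ⟩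
  part l (suc e) ∷ drop (suc e) l ≡⟨ cong₂ _∷_ part≡ (cong (λ k → drop k l) (sym sq≡1+e)) ⟩
  suc e ∷ dropSq l                ∎
  where open ≡-Reasoning

dropSq-dropRect-tight : ∀ {l e} → Linked _≥_ l → sq l ≡ suc e → part l (suc e) ≡ suc e →
                        dropSq (dropRect l) ≡ dropRect (dropSq l)
dropSq-dropRect-tight {l} {e} desc sq≡1+e part≡ = begin
  dropSq (dropRect l)
    ≡⟨ cong dropSq (dropRect-tight desc sq≡1+e part≡) ⟩
  drop (sq (suc e ∷ dropSq l)) (suc e ∷ dropSq l)
    ≡⟨ cong (λ k → drop k (suc e ∷ dropSq l)) (sq-∷ (dropSq l) (s≤s z≤n)) ⟩
  dropRect (dropSq l)
    ∎
  where open ≡-Reasoning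

nu-strict : ∀ k l → StrictSq l → nu (suc k) l ≡ mu (suc k) l
nu-strict k l strict = begin
  nu (suc k) l      ≡⟨ nu-suc k l ⟩
  mu k (dropRect l) ≡⟨ cong (mu k) (dropRect-strict l strict) ⟩
  mu k (dropSq l)   ≡⟨ mu-suc k l ⟨
  mu (suc k) l      ∎
  where open ≡-Reasoning

nu-tight : ∀ k {l e} → Linked _≥_ l → sq l ≡ suc e → part l (suc e) ≡ suc e →
           nu (suc (suc k)) l ≡ nu (suc k) (dropSq l)
nu-tight k {l} desc sq≡1+e part≡ = begin
  nu (suc (suc k)) l           ≡⟨ nu-suc (suc k) l ⟩
  mu (suc k) (dropRect l)      ≡⟨ mu-suc k (dropRect l) ⟩
  mu k (dropSq (dropRect l))   ≡⟨ cong (mu k) (dropSq-dropRect-tight desc sq≡1+e part≡) ⟩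
  mu k (dropRect (dropSq l))   ≡⟨ nu-suc k (dropSq l) ⟨
  nu (suc k) (dropSq l)        ∎
  where open ≡-Reasoning

ExhaustedWithStrictSq : ℕ → List ℕ → Set
ExhaustedWithStrictSq k l = mu k l ≡ [] × ∃[ i ] (i < k × StrictSq (mu i l))

exhausted-tight : ∀ k {l} → TightSq l →
                  ExhaustedWithStrictSq (suc (suc k)) l ⇔ ExhaustedWithStrictSq (suc k) (dropSq l)
exhausted-tight k {l} tight = mk⇔ to from
  where
  to : ExhaustedWithStrictSq (suc (suc k)) l → ExhaustedWithStrictSq (suc k) (dropSq l)
  to (_ , zero , _ , strict) = contradiction tight (strict⇒¬tight l strict)
  to (mu≡[] , suc i , s<s i<k , strict) =
    trans (sym (mu-suc (suc k) l)) mu≡[] , i , i<k , subst StrictSq (mu-suc i l) strict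
  from : ExhaustedWithStrictSq (suc k) (dropSq l) → ExhaustedWithStrictSq (suc (suc k)) l
  from (mu≡[] , i , i<k , strict) =
    trans (mu-suc (suc k) l) mu≡[] , suc i , s<s i<k , subst StrictSq (sym (mu-suc i l)) strict

nu-empty⇔exhausted : ∀ k l → Linked _≥_ l → nu (suc k) l ≡ [] ⇔ ExhaustedWithStrictSq (suc k) l
nu-empty⇔exhausted k l desc with strict⊎tight l
... | inj₁ strict = mk⇔
  (λ nu≡[] → trans (sym (nu-strict k l strict)) nu≡[] , 0 , z<s , strict)
  (λ (mu≡[] , _) → trans (nu-strict k l strict) mu≡[])
nu-empty⇔exhausted zero l desc | inj₂ tight@(e , sq≡1+e , part≡) = mk⇔
  (λ nu≡[] → case trans (sym nu≡[]) (dropRect-tight desc sq≡1+e part≡) of λ ())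
  (λ { (_ , zero , _ , strict) → contradiction tight (strict⇒¬tight l strict)
      ; (_ , suc _ , s<s () , _) })
nu-empty⇔exhausted (suc k) l desc | inj₂ tight@(e , sq≡1+e , part≡) =
  mk⇔ (to ∘ trans (sym skip)) (trans skip ∘ from)
  where
  skip : nu (suc (suc k)) l ≡ nu (suc k) (dropSq l)
  skip = nu-tight k desc sq≡1+e part≡
  open Equivalence (⇔-sym (exhausted-tight k {l} tight)
                    ⇔-∘ nu-empty⇔exhausted k (dropSq l) (linked-drop⁺ (sq l) desc))

mu≡drop-psum : ∀ i l → mu i l ≡ drop (psum i l) l
mu≡drop-psum zero    l = refl
mu≡drop-psum (suc i) l = begin
  dropSq (mu i l)                               ≡⟨ cong (drop (sq (mu i l))) (mu≡drop-psum i l) ⟩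
  drop (sq (mu i l)) (drop (psum i l) l)        ≡⟨ drop-drop (psum i l) (sq (mu i l)) l ⟩
  drop (psum (suc i) l) l                       ∎
  where open ≡-Reasoning

psum+length-mu : ∀ i l → psum i l + length (mu i l) ≡ length l
psum+length-mu zero    l = refl
psum+length-mu (suc i) l = begin
  psum i l + s + length (drop s m) ≡⟨ cong (psum i l + s +_) (length-drop s m) ⟩
  psum i l + s + (length m ∸ s)    ≡⟨ +-assoc (psum i l) s (length m ∸ s) ⟩
  psum i l + (s + (length m ∸ s))  ≡⟨ cong (psum i l +_) (m+[n∸m]≡n (sq-≤-length m)) ⟩
  psum i l + length m              ≡⟨ psum+length-mu i l ⟩
  length l                         ∎
  where
  open ≡-Reasoning
  m = mu i l
  s = sq m

mu-empty-mono : ∀ {j k} l → j ≤ k → mu j l ≡ [] → mu k l ≡ []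
mu-empty-mono {k = zero}  l z≤n   mu≡[] = mu≡[]
mu-empty-mono {k = suc k} l j≤1+k mu≡[] with m≤n⇒m<n∨m≡n j≤1+k
... | inj₁ j≤k  = cong dropSq (mu-empty-mono l (s≤s⁻¹ j≤k) mu≡[])
... | inj₂ refl = mu≡[]

all-mu : ∀ {P : Pred ℕ 0ℓ} i {l} → All P l → All P (mu i l)
all-mu zero    pl = pl
all-mu (suc i) {l} pl = drop⁺ (sq (mu i l)) (all-mu i pl)

strictSq-mu⇔ : ∀ i l → 1 ≤ sq (mu i l) →
               StrictSq (mu i l) ⇔ sq (mu i l) < part l (psum i l + sq (mu i l))
strictSq-mu⇔ i l 1≤sq = mk⇔
  (subst (sq m <_) part≡ ∘ [ (λ sq≡0 → contradiction (subst (1 ≤_) sq≡0 1≤sq) λ ()) , id ]′)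
  (inj₂ ∘ subst (sq m <_) (sym part≡))
  where
  m = mu i l
  part≡ : part m (sq m) ≡ part l (psum i l + sq m)
  part≡ = trans (cong (λ m′ → part m′ (sq m)) (mu≡drop-psum i l)) (part-drop (psum i l) l 1≤sq)

A″⇒exhausted : ∀ k {n l} → InA″ (suc (suc k)) n l → ExhaustedWithStrictSq (suc k) l
A″⇒exhausted k (inj₁ (_ , mu≡[])) =
  cong dropSq mu≡[] , k , ≤-refl , subst StrictSq (sym mu≡[]) (inj₁ refl)
A″⇒exhausted k (inj₂ (_ , _ , _ , zero , () , _))
A″⇒exhausted k {l = l} (inj₂ (_ , nonzero , psum≡len , suc i , _ , i<k , overhang)) =
  mu≡[] , i , i<k , Equivalence.from (strictSq-mu⇔ i l (nonzero (suc i) (s≤s z≤n) i<k)) overhang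
  where
  mu≡[] : mu (suc k) l ≡ []
  mu≡[] = trans (mu≡drop-psum (suc k) l) (drop-all _ l (≤-reflexive (sym psum≡len)))

exhausted⇒A″ : ∀ k {n l} → PartitionOf n l → ExhaustedWithStrictSq (suc k) l →
               InA″ (suc (suc k)) n l
exhausted⇒A″ k {l = l} partition@((pos , _) , _) (mu≡[] , i , i<k , strict)
  with ≡-dec _≟_ (mu k l) []
... | yes mu-k≡[] = inj₁ (partition , mu-k≡[])
... | no mu-k≢[]  = inj₂ (partition , nonzero , psum≡len , suc i , s≤s z≤n , i<k ,
                    Equivalence.to (strictSq-mu⇔ i l (nonzero (suc i) (s≤s z≤n) i<k)) strict)
  where
  mu-nonempty : ∀ {j} → j ≤ k → mu j l ≢ []
  mu-nonempty j≤k = mu-k≢[] ∘ mu-empty-mono l j≤k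
  nonzero : ∀ j → 1 ≤ j → j ≤ suc k → 1 ≤ nsq j l
  nonzero (suc j) _ j<k = sq-pos (all-mu j pos) (mu-nonempty (s≤s⁻¹ j<k))
  psum≡len : psum (suc k) l ≡ length l
  psum≡len = trans (sym (+-identityʳ _))
    (trans (cong (λ m → psum (suc k) l + length m) (sym mu≡[])) (psum+length-mu (suc k) l))

A″⇔exhausted : ∀ k n l →
               InA″ (suc (suc k)) n l ⇔ (PartitionOf n l × ExhaustedWithStrictSq (suc k) l)
A″⇔exhausted k n l = mk⇔
  (λ a → [ proj₁ , proj₁ ]′ a , A″⇒exhausted k a)
  (λ (partition , exhausted) → exhausted⇒A″ k partition exhausted)

D⇔exhausted : ∀ k n l →
              InD (suc (suc k)) n l ⇔ (PartitionOf n l × ExhaustedWithStrictSq (suc k) l)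
D⇔exhausted k n l = mk⇔
  (λ (partition , nu≡[]) → partition , Equivalence.to (nu⇔ partition) nu≡[])
  (λ (partition , exhausted) → partition , Equivalence.from (nu⇔ partition) exhausted)
  where
  nu⇔ : PartitionOf n l → nu (suc k) l ≡ [] ⇔ ExhaustedWithStrictSq (suc k) l
  nu⇔ ((_ , desc) , _) = nu-empty⇔exhausted k l desc

lemma6p3 : ∀ (r n : ℕ) → 2 ≤ r → ∀ (l : List ℕ) → InA″ r n l ⇔ InD r n l
lemma6p3 (suc zero)    n (s≤s ()) l
lemma6p3 (suc (suc k)) n _        l = ⇔-sym (D⇔exhausted k n l) ⇔-∘ A″⇔exhausted k n l
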